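{- Let $\mathcal{S}\in\{\mathsf{DS4},\mathsf{DT}\}$. If $\Delta;\Gamma,\Gamma'\vdash_{\mathcal{S}} M:A$, then $\Delta,\Gamma;\Gamma'\vdash_{\mathcal{S}} M:A$.
   Context: Types: $A,B ::= p_i \mid A\times B\mid A\to B\mid \Box A$. Terms: $M,N ::= x \mid \lambda x{:}A.\,M \mid MN \mid \langle M,N\rangle \mid \pi_1(M)\mid\pi_2(M)\mid \mathsf{box}\,M \mid \mathsf{let\ box}\ u\Leftarrow M\ \mathsf{in}\ N$, with $\mathsf{let\ box}\ u\Leftarrow M\ \mathsf{in}\ N$ binding $u$ in $N$; terms up to $\alpha$-conversion. Contexts $\Gamma ::= \cdot\mid\Gamma,x{:}A$. Judgments $\Delta;\Gamma\vdash M:A$ have a modal context $\Delta$ and an intuitionistic context $\Gamma$ with disjoint sets of variables. Common rules: $\Delta;\Gamma,x{:}A,\Gamma'\vdash x:A$; pairing $\langle M,N\rangle:A\times B$ from $M:A$, $N:B$; $\pi_i(M):A_i$ from $M:A_1\times A_2$; $\lambda x{:}A.M:A\to B$ from $\Delta;\Gamma,x{:}A\vdash M:B$; $MN:B$ from $M:A\to B$, $N:A$; from $\Delta;\Gamma\vdash M:\Box A$ and $\Delta,u{:}A;\Gamma\vdash N:C$ infer $\Delta;\Gamma\vdash\mathsf{let\ box}\ u\Leftarrow M\ \mathsf{in}\ N:C$. Both systems have the rule $\Delta,u{:}A,\Delta';\Gamma\vdash u:A$. $\mathsf{DS4}$ has: from $\Delta;\cdot\vdash M:A$ infer $\Delta;\Gamma\vdash\mathsf{box}\,M:\Box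 A$. $\mathsf{DT}$ has: from $\cdot;\Delta\vdash M:A$ infer $\Delta;\Gamma\vdash\mathsf{box}\,M:\Box A$. -}

module Defs where

open import Data.Nat using (ℕ)
open import Data.Product using (_×_; _,_; proj₁)
open import Data.List using (List; []; _∷_; _++_; map)
open import Data.List.Membership.Propositional using (_∉_)

data Ty : Set where
  p   : ℕ → Ty
  _⊗_ : Ty → Ty → Ty
  _⇒_ : Ty → Ty → Ty
  □   : Ty → Ty

Var : Set
Var = ℕ

data Tm : Set where
  var    : Var → Tm
  lam    : Var → Ty → Tm → Tm
  app    : Tm → Tm → Tm
  pair   : Tm → Tm → Tm
  π₁     : Tm → Tm
  π₂     : Tm → Tm
  box    : Tm → Tm
  letbox : Var → Tm → Tm → Tm   -- let box u ⇐ M in N (binds u in N)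

-- Contexts: snoc-order is represented by list append; Γ , x:A is Γ ++ (x , A) ∷ []
Ctx : Set
Ctx = List (Var × Ty)

dom : Ctx → List Var
dom = map proj₁

_,,_ : Ctx → Var × Ty → Ctx
Γ ,, b = Γ ++ (b ∷ [])

data System : Set where
  DS4 DT : System

-- Δ ; Γ ⊢[ S ] M ∶ A.  Binders require the bound variable to be fresh for
-- both contexts (the disjoint-variables convention, α-conversion chooses names).
data _︔_⊢[_]_∶_ : Ctx → Ctx → System → Tm → Ty → Set where
  hyp   : ∀ {S Δ Γ Γ′ x A} → Δ ︔ (Γ ++ (x , A) ∷ Γ′) ⊢[ S ] var x ∶ A
  mhyp  : ∀ {S Δ Δ′ Γ u A} → (Δ ++ (u , A) ∷ Δ′) ︔ Γ ⊢[ S ] var u ∶ A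
  pairI : ∀ {S Δ Γ M N A B} → Δ ︔ Γ ⊢[ S ] M ∶ A → Δ ︔ Γ ⊢[ S ] N ∶ B →
          Δ ︔ Γ ⊢[ S ] pair M N ∶ (A ⊗ B)
  fstE  : ∀ {S Δ Γ M A B} → Δ ︔ Γ ⊢[ S ] M ∶ (A ⊗ B) → Δ ︔ Γ ⊢[ S ] π₁ M ∶ A
  sndE  : ∀ {S Δ Γ M A B} → Δ ︔ Γ ⊢[ S ] M ∶ (A ⊗ B) → Δ ︔ Γ ⊢[ S ] π₂ M ∶ B
  lamI  : ∀ {S Δ Γ x M A B} → x ∉ dom Δ → x ∉ dom Γ →
          Δ ︔ (Γ ,, (x , A)) ⊢[ S ] M ∶ B → Δ ︔ Γ ⊢[ S ] lam x A M ∶ (A ⇒ B)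
  appE  : ∀ {S Δ Γ M N A B} → Δ ︔ Γ ⊢[ S ] M ∶ (A ⇒ B) → Δ ︔ Γ ⊢[ S ] N ∶ A →
          Δ ︔ Γ ⊢[ S ] app M N ∶ B
  boxE  : ∀ {S Δ Γ u M N A C} → u ∉ dom Δ → u ∉ dom Γ →
          Δ ︔ Γ ⊢[ S ] M ∶ □ A → (Δ ,, (u , A)) ︔ Γ ⊢[ S ] N ∶ C →
          Δ ︔ Γ ⊢[ S ] letbox u M N ∶ C
  boxI-DS4 : ∀ {Δ Γ M A} → Δ ︔ [] ⊢[ DS4 ] M ∶ A → Δ ︔ Γ ⊢[ DS4 ] box M ∶ □ A
  boxI-DT  : ∀ {Δ Γ M A} → [] ︔ Δ ⊢[ DT ] M ∶ A → Δ ︔ Γ ⊢[ DT ] box M ∶ □ A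

-- Bound variables of a term (for the Barendregt variable convention).
bv : Tm → List Var
bv (var x)        = []
bv (lam x A M)    = x ∷ bv M
bv (app M N)      = bv M ++ bv N
bv (pair M N)     = bv M ++ bv N
bv (π₁ M)         = bv M
bv (π₂ M)         = bv M
bv (box M)        = bv M
bv (letbox u M N) = u ∷ bv M ++ bv N

-- The proof generalises the statement to an arbitrary "embedding" of one
-- pair of contexts Δ ; Γ into another Δ′ ; Γ′: every modal hypothesis stays
-- modal, every intuitionistic hypothesis becomes either modal or stays
-- intuitionistic, and every variable of Δ′ ; Γ′ that did not already occur
-- in the corresponding source context belongs to a reserved set E of names
-- which the binders of M avoid.  Embeddings are stable under extending both
-- sides by a binder and under the context manipulations of the two box
-- introduction rules, and the binder side conditions survive because a
-- fresh binder is fresh for the old context and, being bound in M, not in E.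
-- Theorem 6 is the embedding  Δ ; Γ ++ Γ′  into  Δ ++ Γ ; Γ′  with E the
-- domain of the whole context.
module Submission where

open import Defs
open import Data.List using (List; []; _∷_; _++_)
open import Data.List.Properties using (map-++; ++-assoc)
open import Data.List.Membership.Propositional using (_∈_; _∉_)
open import Data.List.Membership.Propositional.Properties
  using (∈-++⁻; ∈-++⁺ˡ; ∈-++⁺ʳ; ∈-∃++; ∈-insert)
open import Data.List.Relation.Binary.Subset.Propositional using (_⊆_)
open import Data.List.Relation.Binary.Subset.Propositional.Properties
  using (xs⊆xs++ys; xs⊆ys++xs; ++⁺ˡ; ++⁺ʳ; map⁺; module ⊆-Reasoning)
open import Data.List.Relation.Unary.Any using (here; there)
open import Data.List.Relation.Unary.Unique.Propositional using (Unique)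
open import Data.Product using (_×_; _,_; proj₁)
open import Data.Sum using ([_,_]′)
open import Function using (_∘_)
open import Relation.Binary.PropositionalEquality using (_≡_; refl; sym; cong)

_Avoids_ : Tm → List Var → Set
M Avoids E = ∀ {x} → x ∈ bv M → x ∉ E

dom-,, : ∀ Γ (b : Var × Ty) → dom (Γ ,, b) ≡ dom Γ ++ proj₁ b ∷ []
dom-,, Γ b = map-++ proj₁ Γ (b ∷ [])

-- The variables of Γ′ are those of Γ plus possibly some from E.
-- This is the invariant that lets freshness of binders be transported.
_⊆_∪_ : Ctx → List Var → Ctx → Set
Γ′ ⊆ E ∪ Γ = dom Γ′ ⊆ E ++ dom Γ

fresh : ∀ {Γ Γ′ E x} → Γ′ ⊆ E ∪ Γ → x ∉ E → x ∉ dom Γ → x ∉ dom Γ′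
fresh {E = E} Γ′⊆ x∉E x∉Γ = [ x∉E , x∉Γ ]′ ∘ ∈-++⁻ E ∘ Γ′⊆

⊆∪-,, : ∀ {Γ′} E Γ b → Γ′ ⊆ E ∪ Γ → (Γ′ ,, b) ⊆ E ∪ (Γ ,, b)
⊆∪-,, {Γ′} E Γ b Γ′⊆ = begin
  dom (Γ′ ,, b)                   ≡⟨ dom-,, Γ′ b ⟩
  dom Γ′ ++ proj₁ b ∷ []          ⊆⟨ ++⁺ˡ (proj₁ b ∷ []) Γ′⊆ ⟩
  (E ++ dom Γ) ++ proj₁ b ∷ []    ≡⟨ ++-assoc E (dom Γ) (proj₁ b ∷ []) ⟩
  E ++ (dom Γ ++ proj₁ b ∷ [])    ≡⟨ cong (E ++_) (sym (dom-,, Γ b)) ⟩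
  E ++ dom (Γ ,, b)               ∎
  where open ⊆-Reasoning Var

record Embedding (Δ Γ Δ′ Γ′ : Ctx) (E : List Var) : Set where
  field
    keepᴹ : Δ ⊆ Δ′
    keepᴵ : Γ ⊆ Δ′ ++ Γ′
    newᴹ  : Δ′ ⊆ E ∪ Δ
    newᴵ  : Γ′ ⊆ E ∪ Γ
open Embedding

embed-,,ᴵ : ∀ {Δ Γ Δ′ Γ′ E} b → Embedding Δ Γ Δ′ Γ′ E →
            Embedding Δ (Γ ,, b) Δ′ (Γ′ ,, b) E
embed-,,ᴵ {Γ = Γ} {Δ′} {Γ′} {E} b e = record
  { keepᴹ = keepᴹ e
  ; keepᴵ = [ grow ∘ keepᴵ e , ∈-++⁺ʳ Δ′ ∘ ∈-++⁺ʳ Γ′ ]′ ∘ ∈-++⁻ Γ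
  ; newᴹ  = newᴹ e
  ; newᴵ  = ⊆∪-,, E Γ b (newᴵ e)
  }
  where
  grow : Δ′ ++ Γ′ ⊆ Δ′ ++ (Γ′ ,, b)
  grow = ++⁺ʳ Δ′ (xs⊆xs++ys Γ′ (b ∷ []))

embed-,,ᴹ : ∀ {Δ Γ Δ′ Γ′ E} b → Embedding Δ Γ Δ′ Γ′ E →
            Embedding (Δ ,, b) Γ (Δ′ ,, b) Γ′ E
embed-,,ᴹ {Δ} {Δ′ = Δ′} {Γ′} {E} b e = record
  { keepᴹ = ++⁺ˡ (b ∷ []) (keepᴹ e)
  ; keepᴵ = grow ∘ keepᴵ e
  ; newᴹ  = ⊆∪-,, E Δ b (newᴹ e)
  ; newᴵ  = newᴵ e
  }
  where
  grow : Δ′ ++ Γ′ ⊆ (Δ′ ,, b) ++ Γ′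
  grow = ++⁺ˡ Γ′ (xs⊆xs++ys Δ′ (b ∷ []))

embed-DS4 : ∀ {Δ Γ Δ′ Γ′ E} → Embedding Δ Γ Δ′ Γ′ E → Embedding Δ [] Δ′ [] E
embed-DS4 e = record { keepᴹ = keepᴹ e ; keepᴵ = λ () ; newᴹ = newᴹ e ; newᴵ = λ () }

embed-DT : ∀ {Δ Γ Δ′ Γ′ E} → Embedding Δ Γ Δ′ Γ′ E → Embedding [] Δ [] Δ′ E
embed-DT e = record { keepᴹ = λ () ; keepᴵ = keepᴹ e ; newᴹ = λ () ; newᴵ = newᴹ e }

embed-fresh : ∀ {Δ Γ Δ′ Γ′ E x} → Embedding Δ Γ Δ′ Γ′ E → x ∉ E →
              x ∉ dom Δ → x ∉ dom Γ → x ∉ dom Δ′ × x ∉ dom Γ′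
embed-fresh e x∉E x∉Δ x∉Γ = fresh (newᴹ e) x∉E x∉Δ , fresh (newᴵ e) x∉E x∉Γ

hypAt : ∀ {S Δ Γ x A} → (x , A) ∈ Γ → Δ ︔ Γ ⊢[ S ] var x ∶ A
hypAt x∈ with _ , _ , refl ← ∈-∃++ x∈ = hyp

mhypAt : ∀ {S Δ Γ x A} → (x , A) ∈ Δ → Δ ︔ Γ ⊢[ S ] var x ∶ A
mhypAt x∈ with _ , _ , refl ← ∈-∃++ x∈ = mhyp

embed : ∀ {S Δ Γ Δ′ Γ′ E M A} → Embedding Δ Γ Δ′ Γ′ E → M Avoids E →
        Δ ︔ Γ ⊢[ S ] M ∶ A → Δ′ ︔ Γ′ ⊢[ S ] M ∶ A
embed {Δ′ = Δ′} e avoid (hyp {Γ = Γ₁}) =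
  [ mhypAt , hypAt ]′ (∈-++⁻ Δ′ (keepᴵ e (∈-insert Γ₁)))
embed e avoid (mhyp {Δ = Δ₁}) = mhypAt (keepᴹ e (∈-insert Δ₁))
embed e avoid (pairI {M = M} d₁ d₂) =
  pairI (embed e (avoid ∘ ∈-++⁺ˡ) d₁) (embed e (avoid ∘ ∈-++⁺ʳ (bv M)) d₂)
embed e avoid (fstE d) = fstE (embed e avoid d)
embed e avoid (sndE d) = sndE (embed e avoid d)
embed e avoid (lamI {x = x} {A = A} x∉Δ x∉Γ d)
  with x∉Δ′ , x∉Γ′ ← embed-fresh e (avoid (here refl)) x∉Δ x∉Γ =
  lamI x∉Δ′ x∉Γ′ (embed (embed-,,ᴵ (x , A) e) (avoid ∘ there) d)
embed e avoid (appE {M = M} d₁ d₂) =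
  appE (embed e (avoid ∘ ∈-++⁺ˡ) d₁) (embed e (avoid ∘ ∈-++⁺ʳ (bv M)) d₂)
embed e avoid (boxE {u = u} {M = M} {A = A} u∉Δ u∉Γ d₁ d₂)
  with u∉Δ′ , u∉Γ′ ← embed-fresh e (avoid (here refl)) u∉Δ u∉Γ =
  boxE u∉Δ′ u∉Γ′ (embed e (avoid ∘ there ∘ ∈-++⁺ˡ) d₁)
                 (embed (embed-,,ᴹ (u , A) e) (avoid ∘ there ∘ ∈-++⁺ʳ (bv M)) d₂)
embed e avoid (boxI-DS4 d) = boxI-DS4 (embed (embed-DS4 e) avoid d)
embed e avoid (boxI-DT d)  = boxI-DT (embed (embed-DT e) avoid d)

theorem6 : ∀ (S : System) (Δ Γ Γ′ : Ctx) (M : Tm) (A : Ty) →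
    Unique (dom (Δ ++ Γ ++ Γ′)) →
    (∀ {x} → x ∈ bv M → x ∉ dom (Δ ++ Γ ++ Γ′)) →
    Δ ︔ (Γ ++ Γ′) ⊢[ S ] M ∶ A → (Δ ++ Γ) ︔ Γ′ ⊢[ S ] M ∶ A
theorem6 S Δ Γ Γ′ M A _ avoid = embed promote avoid
  where
  -- Reserving every variable of the whole context makes the freshness
  -- invariant hold trivially for any subcontext.
  reserved : ∀ {Θ Θ₀} → Θ ⊆ Δ ++ Γ ++ Γ′ → Θ ⊆ dom (Δ ++ Γ ++ Γ′) ∪ Θ₀
  reserved {Θ₀ = Θ₀} Θ⊆ = xs⊆xs++ys _ (dom Θ₀) ∘ map⁺ proj₁ Θ⊆

  promote : Embedding Δ (Γ ++ Γ′) (Δ ++ Γ) Γ′ (dom (Δ ++ Γ ++ Γ′))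
  promote = record
    { keepᴹ = xs⊆xs++ys Δ Γ
    ; keepᴵ = ++⁺ˡ Γ′ (xs⊆ys++xs Γ Δ)
    ; newᴹ  = reserved (++⁺ʳ Δ (xs⊆xs++ys Γ Γ′))
    ; newᴵ  = reserved (∈-++⁺ʳ Δ ∘ ∈-++⁺ʳ Γ)
    }
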